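{- Let $G$ be a finitely generated abelian group, $e\in G$ an element of order two, and $M\ge1$. Then the $(G,\mathbb{Z}/2^M\mathbb{Z})$-property of a function $\alpha\colon G\to\mathbb{Z}/2^M\mathbb{Z}$ of being $(e,\{a,b\})$-boolean for some distinct $a,b\in\mathbb{Z}/2^M\mathbb{Z}$ of opposite parity is expressible.
   Context: For $a,b\in\mathbb{Z}/2^M\mathbb{Z}$ of opposite parity, $\alpha\colon G\to\mathbb{Z}/2^M\mathbb{Z}$ is $(e,\{a,b\})$-boolean if $\alpha$ takes values in $\{a,b\}$ and $\alpha(x+e)=a+b-\alpha(x)$ for all $x\in G$. A $(G,H)$-property (property of functions $\alpha\colon G\to H$, $H$ finite abelian) is expressible if there exist $M'\ge0$, integers $J_1,\dots,J_{M'}\ge0$, $h_{i,j}\in G$ and $E_{i,j}\subset H$ such that $\alpha$ has the property iff for every $i$ and every $x\in G$ the sets $\alpha(x+h_{i,j})+E_{i,j}$, $j=1,\dots,J_i$, are pairwise disjoint with union $H$. -}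

module Defs where

open import Level using (Level)
open import Data.Nat using (ℕ; zero; suc; _+_; _∸_; _^_; NonZero; _≥_)
open import Data.Nat.Properties using (m^n≢0)
open import Data.Nat.DivMod using (_%_; m%n<n)
open import Data.Fin using (Fin; toℕ; fromℕ<)
open import Data.Fin.Subset using (Subset; _∈_)
open import Data.Integer using (ℤ; +_; -[1+_])
open import Data.Product using (Σ; ∃; ∃-syntax; _×_; _,_)
open import Data.Sum using (_⊎_)
open import Relation.Nullary using (¬_)
open import Relation.Binary.PropositionalEquality using (_≡_; _≢_)
open import Function.Bundles using (_⇔_)
open import Algebra.Bundles using (AbelianGroup)
import Algebra.Definitions.RawMonoid as RM

module _ {c ℓ : Level} (G : AbelianGroup c ℓ) where
  open AbelianGroup G
  open RM rawMonoid using () renaming (_×_ to _·ℕ_)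

  zmul : ℤ → Carrier → Carrier
  zmul (+ n)      g = n ·ℕ g
  zmul -[1+ n ]   g = (suc n ·ℕ g) ⁻¹

  gsum : (n : ℕ) → (Fin n → Carrier) → Carrier
  gsum zero    f = ε
  gsum (suc n) f = f Fin.zero ∙ gsum n (λ i → f (Fin.suc i))
    where import Data.Fin as Fin

  FinitelyGenerated : Set (c Level.⊔ ℓ)
  FinitelyGenerated =
    Σ ℕ λ n → Σ (Fin n → Carrier) λ gen →
      ∀ (g : Carrier) → Σ (Fin n → ℤ) λ k → (g ≈ gsum n (λ i → zmul (k i) (gen i)))

  OrderTwo : Carrier → Set ℓ
  OrderTwo e = (¬ (e ≈ ε)) × (e ∙ e ≈ ε)

  Respects≈ : {n : ℕ} → (Carrier → Fin n) → Set (c Level.⊔ ℓ)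
  Respects≈ α = ∀ {x y} → x ≈ y → α x ≡ α y

-- Z/nZ represented by Fin n with modular arithmetic

module _ {n : ℕ} .{{_ : NonZero n}} where
  _⊕_ : Fin n → Fin n → Fin n
  a ⊕ b = fromℕ< (m%n<n (toℕ a + toℕ b) n)

  ⊖_ : Fin n → Fin n
  ⊖ a = fromℕ< (m%n<n (n ∸ toℕ a) n)

  _⊝_ : Fin n → Fin n → Fin n
  a ⊝ b = a ⊕ (⊖ b)

  _∈+_ : Fin n → Fin n × Subset n → Set
  y ∈+ (c , E) = Σ (Fin n) λ t → (t ∈ E) × (y ≡ c ⊕ t)

module _ {c ℓ : Level} (G : AbelianGroup c ℓ) (n : ℕ) .{{_ : NonZero n}} where
  open AbelianGroup G

  Expressible : {p : Level} → ((Carrier → Fin n) → Set p) → Set (c Level.⊔ ℓ Level.⊔ p)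
  Expressible P =
    Σ ℕ λ M' →
    Σ (Fin M' → ℕ) λ J →
    Σ ((i : Fin M') → Fin (J i) → Carrier) λ h →
    Σ ((i : Fin M') → Fin (J i) → Subset n) λ E →
      ∀ (α : Carrier → Fin n) → Respects≈ G α →
        P α ⇔
        (∀ (i : Fin M') (x : Carrier) →
           (∀ (j j' : Fin (J i)) → j ≢ j' → ∀ (y : Fin n) →
              ¬ ((y ∈+ (α (x ∙ h i j) , E i j)) × (y ∈+ (α (x ∙ h i j') , E i j'))))
           ×
           (∀ (y : Fin n) → ∃[ j ] (y ∈+ (α (x ∙ h i j) , E i j))))

module _ (M : ℕ) where
  private instance
    2^M≢0 : NonZero (2 ^ M)
    2^M≢0 = m^n≢0 2 M

  ZMod2^ : Set
  ZMod2^ = Fin (2 ^ M)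

  parity : ZMod2^ → ℕ
  parity a = toℕ a % 2

  OppositeParity : ZMod2^ → ZMod2^ → Set
  OppositeParity a b = parity a ≢ parity b

  module _ {c ℓ : Level} (G : AbelianGroup c ℓ) where
    open AbelianGroup G

    IsBoolean : Carrier → ZMod2^ → ZMod2^ → (Carrier → ZMod2^) → Set c
    IsBoolean e a b α =
      (∀ x → (α x ≡ a) ⊎ (α x ≡ b)) ×
      (∀ x → α (x ∙ e) ≡ (a ⊕ b) ⊝ α x)

    BooleanForSome : Carrier → (Carrier → ZMod2^) → Set c
    BooleanForSome e α =
      ∃[ a ] ∃[ b ] (a ≢ b × OppositeParity a b × IsBoolean e a b α)

-- Write H = ℤ/2^Mℤ and 2H for its even residues.  The two sets α x + 2H and α (x ∙ e) + 2H
-- tile H exactly when α x and α (x ∙ e) have opposite parity.  Granting this at every point,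
-- for a generator g the four sets α x + {0}, α (x ∙ e) + {0}, α (x ∙ g) + (2H ∖ {0}) and
-- α (x ∙ g ∙ e) + (2H ∖ {0}) tile H exactly when {α (x ∙ g), α (x ∙ g ∙ e)} = {α x, α (x ∙ e)}
-- as unordered pairs.  So the constraints say that the unordered pair {α x, α (x ∙ e)} has
-- opposite parities and is invariant under translation by the generators, hence by all of G;
-- that is, α takes two values a, b of opposite parity and α (x ∙ e) = a + b − α x.

module Submission where

open import Defs
open import Level using (Level; _⊔_)
open import Algebra.Bundles using (AbelianGroup)
import Algebra.Definitions.RawMonoid as RawMonoidDefinitions
open import Data.Bool using (true)
open import Data.Bool.Properties using (T-≡)
open import Data.Nat as ℕ using (ℕ; zero; suc; _+_; _∸_; _^_; _<_; _≥_; NonZero; s≤s; z≤n)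
open import Data.Nat.Properties using (m^n≢0; +-comm; +-assoc; m∸n+n≡m; <⇒≤)
open import Data.Nat.DivMod
  using (_%_; m%n<n; %-distribˡ-+; m%n%n≡m%n; n%n≡0; m<n⇒m%n≡m; m∣n⇒o%n%m≡o%m)
open import Data.Nat.Divisibility using (_∣_; m∣m*n)
open import Data.Fin using (Fin; zero; suc; toℕ)
open import Data.Fin.Properties using (toℕ-injective; toℕ<n; toℕ-fromℕ<) renaming (_≟_ to _≟ᶠ_)
open import Data.Fin.Subset using (Subset; _∈_)
open import Data.Vec using (tabulate)
open import Data.Vec.Properties using (lookup∘tabulate; []=⇒lookup; lookup⇒[]=)
open import Data.Vec.Functional using ([]; _∷_)
open import Data.Integer using (ℤ; +_; -[1+_])
open import Data.Product using (Σ; ∃-syntax; _×_; _,_; proj₁; proj₂; swap)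
open import Data.Product.Function.NonDependent.Propositional using (_×-⇔_)
open import Data.Unit using (⊤; tt)
open import Data.Sum using (_⊎_; inj₁; inj₂)
open import Function using (_∘_)
open import Function.Bundles using (_⇔_; mk⇔; Equivalence)
import Function.Properties.Equivalence as ⇔
open import Function.Construct.Identity using (⇔-id)
open import Relation.Nullary using (¬_; Dec; yes; no; does; ¬?; contradiction)
open import Relation.Nullary.Decidable using (toWitness; isYes≗does; dec-true; decidable-stable; _×-dec_)
open import Relation.Unary using (Decidable)
open import Relation.Binary.PropositionalEquality

open Equivalence using (to; from)

%-absorbˡ : ∀ m n d .{{_ : NonZero d}} → (m % d + n) % d ≡ (m + n) % d
%-absorbˡ m n d = begin
  (m % d + n) % d           ≡⟨ %-distribˡ-+ (m % d) n d ⟩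
  (m % d % d + n % d) % d   ≡⟨ cong (λ k → (k + n % d) % d) (m%n%n≡m%n m d) ⟩
  (m % d + n % d) % d       ≡⟨ %-distribˡ-+ m n d ⟨
  (m + n) % d               ∎
  where open ≡-Reasoning

%-absorbʳ : ∀ m n d .{{_ : NonZero d}} → (m + n % d) % d ≡ (m + n) % d
%-absorbʳ m n d = begin
  (m + n % d) % d   ≡⟨ cong (_% d) (+-comm m (n % d)) ⟩
  (n % d + m) % d   ≡⟨ %-absorbˡ n m d ⟩
  (n + m) % d       ≡⟨ cong (_% d) (+-comm n m) ⟩
  (m + n) % d       ∎
  where open ≡-Reasoning

third-of-two : ∀ {u v w} → u < 2 → v < 2 → w < 2 → u ≢ v → w ≢ u → w ≡ v
third-of-two (s≤s z≤n)       (s≤s z≤n)       _               u≢v _   = contradiction refl u≢v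
third-of-two (s≤s (s≤s z≤n)) (s≤s (s≤s z≤n)) _               u≢v _   = contradiction refl u≢v
third-of-two (s≤s z≤n)       (s≤s (s≤s z≤n)) (s≤s z≤n)       _   w≢u = contradiction refl w≢u
third-of-two (s≤s z≤n)       (s≤s (s≤s z≤n)) (s≤s (s≤s z≤n)) _   _   = refl
third-of-two (s≤s (s≤s z≤n)) (s≤s z≤n)       (s≤s z≤n)       _   _   = refl
third-of-two (s≤s (s≤s z≤n)) (s≤s z≤n)       (s≤s (s≤s z≤n)) _   w≢u = contradiction refl w≢u

[u+w]%2≡u⇔w≡0 : ∀ {u w} → u < 2 → w < 2 → (u + w) % 2 ≡ u ⇔ w ≡ 0
[u+w]%2≡u⇔w≡0 (s≤s z≤n)       (s≤s z≤n)       = mk⇔ (λ _ → refl) (λ _ → refl)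
[u+w]%2≡u⇔w≡0 (s≤s z≤n)       (s≤s (s≤s z≤n)) = mk⇔ (λ ()) (λ ())
[u+w]%2≡u⇔w≡0 (s≤s (s≤s z≤n)) (s≤s z≤n)       = mk⇔ (λ _ → refl) (λ _ → refl)
[u+w]%2≡u⇔w≡0 (s≤s (s≤s z≤n)) (s≤s (s≤s z≤n)) = mk⇔ (λ ()) (λ ())

module _ {A : Set} {J : ℕ} (Q : Fin J → A → Set) where

  Disjoint : Set
  Disjoint = ∀ j j' → j ≢ j' → ∀ y → ¬ (Q j y × Q j' y)

  Covering : Set
  Covering = ∀ y → ∃[ j ] Q j y

  Partition : Set
  Partition = Disjoint × Covering

module _ {A : Set} where

  partition-cong : ∀ {J} {Q R : Fin J → A → Set} → (∀ j y → Q j y ⇔ R j y) →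
                   Partition Q ⇔ Partition R
  partition-cong Q⇔R = mk⇔ (transport Q⇔R) (transport (λ j y → ⇔.sym (Q⇔R j y)))
    where
    transport : ∀ {J} {Q R : Fin J → A → Set} → (∀ j y → Q j y ⇔ R j y) →
                Partition Q → Partition R
    transport Q⇔R (disjoint , cover) =
      (λ j j' j≢j' y (Rjy , Rj'y) →
         disjoint j j' j≢j' y (from (Q⇔R j y) Rjy , from (Q⇔R j' y) Rj'y)) ,
      (λ y → let j , Qjy = cover y in j , to (Q⇔R j y) Qjy)

  partition-trivial : Partition {A = A} {J = 1} (λ _ _ → ⊤)
  partition-trivial = (λ { zero zero 0≢0 _ _ → 0≢0 refl }) , (λ _ → zero , tt)

  _orElse_ : ∀ {J} → (A → Set) → (Fin J → A → Set) → Fin (suc J) → A → Set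
  P orElse R = P ∷ λ j y → ¬ P y × R j y

  partition-orElse : ∀ {J} {P : A → Set} {R : Fin J → A → Set} → Decidable P → Partition R →
                     Partition (P orElse R)
  partition-orElse {P = P} {R} P? (disjointR , coverR) = disjoint , cover
    where
    disjoint : Disjoint (P orElse R)
    disjoint zero    zero     j≢j' _ _                  = contradiction refl j≢j'
    disjoint zero    (suc _)  _    _ (p , ¬p , _)       = ¬p p
    disjoint (suc _) zero     _    _ ((¬p , _) , p)     = ¬p p
    disjoint (suc j) (suc j') j≢j' y ((_ , r) , _ , r') = disjointR j j' (j≢j' ∘ cong suc) y (r , r')
    cover : Covering (P orElse R)
    cover y with P? y
    ... | yes p = zero , p
    ... | no ¬p = let j , r = coverR y in suc j , ¬p , r

  partition-reindex : ∀ {J} {Q : Fin J → A → Set} (π : Fin J → Fin J) →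
                      (∀ j → π (π j) ≡ j) → Partition Q → Partition (Q ∘ π)
  partition-reindex {Q = Q} π involutive (disjoint , cover) =
    (λ j j' j≢j' → disjoint (π j) (π j') (j≢j' ∘ π-injective)) ,
    (λ y → let j , Qjy = cover y in π j , subst (λ k → Q k y) (sym (involutive j)) Qjy)
    where
    π-injective : ∀ {j j'} → π j ≡ π j' → j ≡ j'
    π-injective {j} {j'} eq = trans (sym (involutive j)) (trans (cong π eq) (involutive j'))

module _ {A : Set} where

  infix 4 _∼_

  _∼_ : A × A → A × A → Set
  p ∼ q = p ≡ q ⊎ p ≡ swap q

  ∼-sym : ∀ {p q} → p ∼ q → q ∼ p
  ∼-sym (inj₁ refl) = inj₁ refl
  ∼-sym (inj₂ refl) = inj₂ refl

  ∼-trans : ∀ {p q r} → p ∼ q → q ∼ r → p ∼ r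
  ∼-trans (inj₁ refl) q∼r         = q∼r
  ∼-trans (inj₂ refl) (inj₁ refl) = inj₂ refl
  ∼-trans (inj₂ refl) (inj₂ refl) = inj₁ refl

module ZMod {n : ℕ} .{{_ : NonZero n}} where

  toℕ-⊕ : ∀ (a b : Fin n) → toℕ (a ⊕ b) ≡ (toℕ a + toℕ b) % n
  toℕ-⊕ a b = toℕ-fromℕ< _

  ⊕-comm : ∀ (a b : Fin n) → a ⊕ b ≡ b ⊕ a
  ⊕-comm a b = toℕ-injective (begin
    toℕ (a ⊕ b)             ≡⟨ toℕ-⊕ a b ⟩
    (toℕ a + toℕ b) % n     ≡⟨ cong (_% n) (+-comm (toℕ a) (toℕ b)) ⟩
    (toℕ b + toℕ a) % n     ≡⟨ toℕ-⊕ b a ⟨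
    toℕ (b ⊕ a)             ∎)
    where open ≡-Reasoning

  ⊕-assoc : ∀ (a b c : Fin n) → (a ⊕ b) ⊕ c ≡ a ⊕ (b ⊕ c)
  ⊕-assoc a b c = toℕ-injective (begin
    toℕ ((a ⊕ b) ⊕ c)                  ≡⟨ toℕ-⊕ (a ⊕ b) c ⟩
    (toℕ (a ⊕ b) + C) % n              ≡⟨ cong (λ k → (k + C) % n) (toℕ-⊕ a b) ⟩
    ((A + B) % n + C) % n              ≡⟨ %-absorbˡ (A + B) C n ⟩
    (A + B + C) % n                    ≡⟨ cong (_% n) (+-assoc A B C) ⟩
    (A + (B + C)) % n                  ≡⟨ %-absorbʳ A (B + C) n ⟨
    (A + (B + C) % n) % n              ≡⟨ cong (λ k → (A + k) % n) (toℕ-⊕ b c) ⟨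
    (A + toℕ (b ⊕ c)) % n              ≡⟨ toℕ-⊕ a (b ⊕ c) ⟨
    toℕ (a ⊕ (b ⊕ c))                  ∎)
    where
    open ≡-Reasoning
    A = toℕ a
    B = toℕ b
    C = toℕ c

  -- Fin n has no zero constructor unless n is a successor, so zero is recognised through toℕ.
  ⊕-identityˡ : ∀ {z} (a : Fin n) → toℕ z ≡ 0 → z ⊕ a ≡ a
  ⊕-identityˡ {z} a z≡0 = toℕ-injective (begin
    toℕ (z ⊕ a)           ≡⟨ toℕ-⊕ z a ⟩
    (toℕ z + toℕ a) % n   ≡⟨ cong (λ k → (k + toℕ a) % n) z≡0 ⟩
    toℕ a % n             ≡⟨ m<n⇒m%n≡m (toℕ<n a) ⟩
    toℕ a                 ∎)
    where open ≡-Reasoning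

  ⊖-inverseˡ : ∀ (a : Fin n) → toℕ ((⊖ a) ⊕ a) ≡ 0
  ⊖-inverseˡ a = begin
    toℕ ((⊖ a) ⊕ a)               ≡⟨ toℕ-⊕ (⊖ a) a ⟩
    (toℕ (⊖ a) + toℕ a) % n       ≡⟨ cong (λ k → (k + toℕ a) % n) (toℕ-fromℕ< _) ⟩
    ((n ∸ toℕ a) % n + toℕ a) % n ≡⟨ %-absorbˡ (n ∸ toℕ a) (toℕ a) n ⟩
    (n ∸ toℕ a + toℕ a) % n       ≡⟨ cong (_% n) (m∸n+n≡m (<⇒≤ (toℕ<n a))) ⟩
    n % n                         ≡⟨ n%n≡0 n ⟩
    0                             ∎
    where open ≡-Reasoning

  ⊕-⊝-cancelˡ : ∀ (c t : Fin n) → (c ⊕ t) ⊝ c ≡ t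
  ⊕-⊝-cancelˡ c t = begin
    (c ⊕ t) ⊕ (⊖ c)   ≡⟨ ⊕-comm (c ⊕ t) (⊖ c) ⟩
    (⊖ c) ⊕ (c ⊕ t)   ≡⟨ ⊕-assoc (⊖ c) c t ⟨
    ((⊖ c) ⊕ c) ⊕ t   ≡⟨ ⊕-identityˡ t (⊖-inverseˡ c) ⟩
    t                 ∎
    where open ≡-Reasoning

  ⊕-⊝-cancelʳ : ∀ (t c : Fin n) → (t ⊕ c) ⊝ c ≡ t
  ⊕-⊝-cancelʳ t c = trans (cong (_⊝ c) (⊕-comm t c)) (⊕-⊝-cancelˡ c t)

  ⊕-⊝-inverse : ∀ (c y : Fin n) → c ⊕ (y ⊝ c) ≡ y
  ⊕-⊝-inverse c y = begin
    c ⊕ (y ⊕ (⊖ c))   ≡⟨ cong (c ⊕_) (⊕-comm y (⊖ c)) ⟩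
    c ⊕ ((⊖ c) ⊕ y)   ≡⟨ ⊕-assoc c (⊖ c) y ⟨
    (c ⊕ (⊖ c)) ⊕ y   ≡⟨ cong (_⊕ y) (⊕-comm c (⊖ c)) ⟩
    ((⊖ c) ⊕ c) ⊕ y   ≡⟨ ⊕-identityˡ y (⊖-inverseˡ c) ⟩
    y                 ∎
    where open ≡-Reasoning

  toℕ[y⊝c]≡0⇔y≡c : ∀ (y c : Fin n) → toℕ (y ⊝ c) ≡ 0 ⇔ y ≡ c
  toℕ[y⊝c]≡0⇔y≡c y c = mk⇔ to′ from′
    where
    to′ : toℕ (y ⊝ c) ≡ 0 → y ≡ c
    to′ t≡0 = begin
      y                 ≡⟨ ⊕-⊝-inverse c y ⟨
      c ⊕ (y ⊝ c)       ≡⟨ ⊕-comm c (y ⊝ c) ⟩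
      (y ⊝ c) ⊕ c       ≡⟨ ⊕-identityˡ c t≡0 ⟩
      c                 ∎
      where open ≡-Reasoning
    from′ : y ≡ c → toℕ (y ⊝ c) ≡ 0
    from′ refl = trans (cong toℕ (⊕-comm y (⊖ y))) (⊖-inverseˡ y)

  subsetOf : {P : Fin n → Set} → Decidable P → Subset n
  subsetOf P? = tabulate (does ∘ P?)

  ∈-subsetOf⇔ : ∀ {P : Fin n → Set} (P? : Decidable P) {t} → t ∈ subsetOf P? ⇔ P t
  ∈-subsetOf⇔ P? {t} = mk⇔
    (λ t∈ → toWitness {a? = P? t} (from T-≡ (trans (isYes≗does (P? t)) (does≡true t∈))))
    (λ Pt → lookup⇒[]= t _ (trans (lookup∘tabulate _ t) (dec-true (P? t) Pt)))
    where
    does≡true : t ∈ subsetOf P? → does (P? t) ≡ true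
    does≡true t∈ = trans (sym (lookup∘tabulate _ t)) ([]=⇒lookup t∈)

  ∈+-subsetOf⇔ : ∀ {P : Fin n → Set} (P? : Decidable P) {y c} →
                 y ∈+ (c , subsetOf P?) ⇔ P (y ⊝ c)
  ∈+-subsetOf⇔ {P} P? {y} {c} = mk⇔
    (λ { (t , t∈ , refl) → subst P (sym (⊕-⊝-cancelˡ c t)) (to (∈-subsetOf⇔ P?) t∈) })
    (λ P[y⊝c] → y ⊝ c , from (∈-subsetOf⇔ P?) P[y⊝c] , sym (⊕-⊝-inverse c y))

  zero? : Decidable (λ (t : Fin n) → toℕ t ≡ 0)
  zero? t = toℕ t ℕ.≟ 0

  zeroSet : Subset n
  zeroSet = subsetOf zero?

  ∈+-zeroSet⇔ : ∀ (y c : Fin n) → y ∈+ (c , zeroSet) ⇔ y ≡ c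
  ∈+-zeroSet⇔ y c = ⇔.trans (∈+-subsetOf⇔ zero?) (toℕ[y⊝c]≡0⇔y≡c y c)

  Tiles : ∀ {J} → (Fin J → Fin n) → (Fin J → Subset n) → Set
  Tiles v E = Partition (λ j y → y ∈+ (v j , E j))

  tiles-cong : ∀ {J} {v w : Fin J → Fin n} (E : Fin J → Subset n) → (∀ j → v j ≡ w j) →
               Tiles v E ⇔ Tiles w E
  tiles-cong E v≗w = partition-cong λ j y →
    mk⇔ (subst (λ c → y ∈+ (c , E j)) (v≗w j)) (subst (λ c → y ∈+ (c , E j)) (sym (v≗w j)))

  boolean-pair⇔ : ∀ {a b u w : Fin n} →
                  (((u ≡ a) ⊎ (u ≡ b)) × (w ≡ (a ⊕ b) ⊝ u)) ⇔ (u , w) ∼ (a , b)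
  boolean-pair⇔ {a} {b} = mk⇔
    (λ { (inj₁ refl , w≡) → inj₁ (cong (a ,_) (trans w≡ (⊕-⊝-cancelˡ a b)))
       ; (inj₂ refl , w≡) → inj₂ (cong (b ,_) (trans w≡ (⊕-⊝-cancelʳ a b))) })
    (λ { (inj₁ refl) → inj₁ refl , sym (⊕-⊝-cancelˡ a b)
       ; (inj₂ refl) → inj₂ refl , sym (⊕-⊝-cancelʳ a b) })

module Parity (M : ℕ) (M≥1 : M ≥ 1) where

  instance
    2^M≢0 : NonZero (2 ^ M)
    2^M≢0 = m^n≢0 2 M

  open ZMod {2 ^ M}

  F : Set
  F = ZMod2^ M

  parity<2 : ∀ (a : F) → parity M a < 2
  parity<2 a = m%n<n (toℕ a) 2

  parity-⊕ : ∀ (a b : F) → parity M (a ⊕ b) ≡ (parity M a + parity M b) % 2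
  parity-⊕ a b = begin
    toℕ (a ⊕ b) % 2                 ≡⟨ cong (_% 2) (toℕ-⊕ a b) ⟩
    (toℕ a + toℕ b) % (2 ^ M) % 2   ≡⟨ m∣n⇒o%n%m≡o%m 2 (2 ^ M) _ (2∣2^M M≥1) ⟩
    (toℕ a + toℕ b) % 2             ≡⟨ %-distribˡ-+ (toℕ a) (toℕ b) 2 ⟩
    (toℕ a % 2 + toℕ b % 2) % 2     ∎
    where
    open ≡-Reasoning
    2∣2^M : ∀ {M} → M ≥ 1 → 2 ∣ 2 ^ M
    2∣2^M {suc M} _ = m∣m*n (2 ^ M)

  SameParityAs : F → F → Set
  SameParityAs c y = parity M y ≡ parity M c

  Punctured : F → F → Set
  Punctured c y = y ≢ c × SameParityAs c y

  parity[y⊝c]≡0⇔ : ∀ (y c : F) → parity M (y ⊝ c) ≡ 0 ⇔ SameParityAs c y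
  parity[y⊝c]≡0⇔ y c = mk⇔
    (λ t≡0 → trans parity-y (from sum≡c⇔t≡0 t≡0))
    (λ y≡c → to sum≡c⇔t≡0 (trans (sym parity-y) y≡c))
    where
    parity-y : parity M y ≡ (parity M c + parity M (y ⊝ c)) % 2
    parity-y = trans (cong (parity M) (sym (⊕-⊝-inverse c y))) (parity-⊕ c (y ⊝ c))
    sum≡c⇔t≡0 : (parity M c + parity M (y ⊝ c)) % 2 ≡ parity M c ⇔ parity M (y ⊝ c) ≡ 0
    sum≡c⇔t≡0 = [u+w]%2≡u⇔w≡0 (parity<2 c) (parity<2 (y ⊝ c))

  even? : Decidable (λ (t : F) → parity M t ≡ 0)
  even? t = parity M t ℕ.≟ 0

  evenSet : Subset (2 ^ M)
  evenSet = subsetOf even?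

  ∈+-evenSet⇔ : ∀ (y c : F) → y ∈+ (c , evenSet) ⇔ SameParityAs c y
  ∈+-evenSet⇔ y c = ⇔.trans (∈+-subsetOf⇔ even?) (parity[y⊝c]≡0⇔ y c)

  nonzeroEven? : Decidable (λ (t : F) → toℕ t ≢ 0 × parity M t ≡ 0)
  nonzeroEven? t = ¬? (zero? t) ×-dec even? t

  nonzeroEvenSet : Subset (2 ^ M)
  nonzeroEvenSet = subsetOf nonzeroEven?

  ∈+-nonzeroEvenSet⇔ : ∀ (y c : F) → y ∈+ (c , nonzeroEvenSet) ⇔ Punctured c y
  ∈+-nonzeroEvenSet⇔ y c = ⇔.trans (∈+-subsetOf⇔ nonzeroEven?) (mk⇔
    (λ (t≢0 , t-even) → t≢0 ∘ from (toℕ[y⊝c]≡0⇔y≡c y c) , to (parity[y⊝c]≡0⇔ y c) t-even)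
    (λ (y≢c , p) → y≢c ∘ to (toℕ[y⊝c]≡0⇔y≡c y c) , from (parity[y⊝c]≡0⇔ y c) p))

  sameParityAs? : ∀ c → Decidable (SameParityAs c)
  sameParityAs? c y = parity M y ℕ.≟ parity M c

  PointsAndPunctured : F → F → F → F → Fin 4 → F → Set
  PointsAndPunctured a b c d = (_≡ a) ∷ (_≡ b) ∷ Punctured c ∷ Punctured d ∷ []

  swap₂₃ : Fin 4 → Fin 4
  swap₂₃ zero                   = zero
  swap₂₃ (suc zero)             = suc zero
  swap₂₃ (suc (suc zero))       = suc (suc (suc zero))
  swap₂₃ (suc (suc (suc zero))) = suc (suc zero)

  swap₂₃-involutive : ∀ j → swap₂₃ (swap₂₃ j) ≡ j
  swap₂₃-involutive zero                   = refl
  swap₂₃-involutive (suc zero)             = refl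
  swap₂₃-involutive (suc (suc zero))       = refl
  swap₂₃-involutive (suc (suc (suc zero))) = refl

  module OppositePair (a b : F) (opp : OppositeParity M a b) where

    not-both-parities : ∀ y → ¬ (SameParityAs a y × SameParityAs b y)
    not-both-parities y (p , q) = opp (trans (sym p) q)

    third-parity : ∀ y → ¬ SameParityAs a y → SameParityAs b y
    third-parity y = third-of-two (parity<2 a) (parity<2 b) (parity<2 y) opp

    partition-sameParity : Partition (SameParityAs a ∷ SameParityAs b ∷ [])
    partition-sameParity =
      to (partition-cong classes) (partition-orElse (sameParityAs? a) partition-trivial)
      where
      classes : ∀ j y → (SameParityAs a orElse λ _ _ → ⊤) j y ⇔
                        (SameParityAs a ∷ SameParityAs b ∷ []) j y
      classes zero       y = ⇔-id _
      classes (suc zero) y =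
        mk⇔ (third-parity y ∘ proj₁) λ q → (λ p → not-both-parities y (p , q)) , tt

    partition-pointsAndPunctured : Partition (PointsAndPunctured a b a b)
    partition-pointsAndPunctured = to (partition-cong classes)
      (partition-orElse (_≟ᶠ a) (partition-orElse (_≟ᶠ b)
        (partition-orElse (sameParityAs? a) partition-trivial)))
      where
      classes : ∀ j y → ((_≡ a) orElse ((_≡ b) orElse (SameParityAs a orElse λ _ _ → ⊤))) j y ⇔
                        PointsAndPunctured a b a b j y
      classes zero                   y = ⇔-id _
      classes (suc zero)             y = mk⇔ proj₂
        λ y≡b → (λ y≡a → not-both-parities y (cong (parity M) y≡a , cong (parity M) y≡b)) , y≡b
      classes (suc (suc zero))       y = mk⇔ (λ (y≢a , _ , p) → y≢a , p)
        λ (y≢a , p) → y≢a , (λ y≡b → not-both-parities y (p , cong (parity M) y≡b)) , p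
      classes (suc (suc (suc zero))) y = mk⇔ (λ (_ , y≢b , ¬p , _) → y≢b , third-parity y ¬p)
        λ (y≢b , q) → (λ y≡a → not-both-parities y (cong (parity M) y≡a , q)) , y≢b ,
                      (λ p → not-both-parities y (p , q)) , tt

    ∼⇒partition-pointsAndPunctured : ∀ {c d} → (c , d) ∼ (a , b) →
                                     Partition (PointsAndPunctured a b c d)
    ∼⇒partition-pointsAndPunctured (inj₁ refl) = partition-pointsAndPunctured
    ∼⇒partition-pointsAndPunctured (inj₂ refl) = to (partition-cong reindexed)
      (partition-reindex swap₂₃ swap₂₃-involutive partition-pointsAndPunctured)
      where
      reindexed : ∀ j y → PointsAndPunctured a b a b (swap₂₃ j) y ⇔ PointsAndPunctured a b b a j y
      reindexed zero                   y = ⇔-id _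
      reindexed (suc zero)             y = ⇔-id _
      reindexed (suc (suc zero))       y = ⇔-id _
      reindexed (suc (suc (suc zero))) y = ⇔-id _

    partition-pointsAndPunctured⇒∼ : ∀ {c d} → OppositeParity M c d →
                                     Partition (PointsAndPunctured a b c d) → (c , d) ∼ (a , b)
    partition-pointsAndPunctured⇒∼ {c} {d} opp′ (disjoint , _) = by-parity-of-c (sameParityAs? a c)
      where
      -- The centre z of a punctured class equals the point w of {a, b} of the same parity,
      -- since otherwise w would lie both in {w} and in that punctured class.
      forced : ∀ {w z} j k → j ≢ k → PointsAndPunctured a b c d j w →
               (w ≢ z → PointsAndPunctured a b c d k w) → z ≡ w
      forced {w} {z} j k j≢k in-j in-k =
        decidable-stable (z ≟ᶠ w) λ z≢w → disjoint j k j≢k w (in-j , in-k (z≢w ∘ sym))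

      by-parity-of-c : Dec (SameParityAs a c) → (c , d) ∼ (a , b)
      by-parity-of-c (yes pc≡pa) =
        inj₁ (cong₂ _,_ (forced zero (suc (suc zero)) (λ ()) refl (λ a≢c → a≢c , sym pc≡pa))
                        (forced (suc zero) (suc (suc (suc zero))) (λ ()) refl (λ b≢d → b≢d , sym pd≡pb)))
        where
        pd≡pb : SameParityAs b d
        pd≡pb = third-parity d λ pd≡pa → opp′ (trans pc≡pa (sym pd≡pa))
      by-parity-of-c (no pc≢pa) =
        inj₂ (cong₂ _,_ (forced (suc zero) (suc (suc zero)) (λ ()) refl (λ b≢c → b≢c , sym pc≡pb))
                        (forced zero (suc (suc (suc zero))) (λ ()) refl (λ a≢d → a≢d , sym pd≡pa)))
        where
        pc≡pb : SameParityAs b c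
        pc≡pb = third-parity c pc≢pa
        pd≡pa : SameParityAs a d
        pd≡pa = third-of-two (parity<2 b) (parity<2 a) (parity<2 d) (opp ∘ sym)
                  λ pd≡pb → opp′ (trans pc≡pb (sym pd≡pb))

  tiles-parity⇔ : ∀ (a b : F) → Tiles (a ∷ b ∷ []) (λ _ → evenSet) ⇔ OppositeParity M a b
  tiles-parity⇔ a b = ⇔.trans (partition-cong classes) (mk⇔
    (λ (disjoint , _) pa≡pb → disjoint zero (suc zero) (λ ()) a (refl , pa≡pb))
    (OppositePair.partition-sameParity a b))
    where
    classes : ∀ j y → y ∈+ ((a ∷ b ∷ []) j , evenSet) ⇔
                      (SameParityAs a ∷ SameParityAs b ∷ []) j y
    classes zero       y = ∈+-evenSet⇔ y a
    classes (suc zero) y = ∈+-evenSet⇔ y b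

  quadSets : Fin 4 → Subset (2 ^ M)
  quadSets = zeroSet ∷ zeroSet ∷ nonzeroEvenSet ∷ nonzeroEvenSet ∷ []

  tiles-quad⇔ : ∀ {a b c d : F} → OppositeParity M a b → OppositeParity M c d →
                Tiles (a ∷ b ∷ c ∷ d ∷ []) quadSets ⇔ (c , d) ∼ (a , b)
  tiles-quad⇔ {a} {b} {c} {d} opp opp′ = ⇔.trans (partition-cong classes)
    (mk⇔ (partition-pointsAndPunctured⇒∼ opp′) ∼⇒partition-pointsAndPunctured)
    where
    open OppositePair a b opp
    classes : ∀ j y → y ∈+ ((a ∷ b ∷ c ∷ d ∷ []) j , quadSets j) ⇔ PointsAndPunctured a b c d j y
    classes zero                   y = ∈+-zeroSet⇔ y a
    classes (suc zero)             y = ∈+-zeroSet⇔ y b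
    classes (suc (suc zero))       y = ∈+-nonzeroEvenSet⇔ y c
    classes (suc (suc (suc zero))) y = ∈+-nonzeroEvenSet⇔ y d

module _ {c ℓ : Level} (G : AbelianGroup c ℓ) where
  open AbelianGroup G using (Carrier; _≈_; _∙_; ε; _⁻¹; rawMonoid) renaming (sym to ≈-sym)
  open RawMonoidDefinitions rawMonoid using () renaming (_×_ to _·ℕ_)

  record IsSubgroup {p} (P : Carrier → Set p) : Set (c ⊔ ℓ ⊔ p) where
    field
      ∈-resp-≈  : ∀ {x y} → x ≈ y → P x → P y
      ε-closed  : P ε
      ∙-closed  : ∀ {x y} → P x → P y → P (x ∙ y)
      ⁻¹-closed : ∀ {x} → P x → P (x ⁻¹)

  module _ {p} {P : Carrier → Set p} (subgroup : IsSubgroup P) where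
    open IsSubgroup subgroup

    ·ℕ-closed : ∀ k {g} → P g → P (k ·ℕ g)
    ·ℕ-closed zero    _  = ε-closed
    ·ℕ-closed (suc k) Pg = ∙-closed Pg (·ℕ-closed k Pg)

    zmul-closed : ∀ k {g} → P g → P (zmul G k g)
    zmul-closed (+ k)    Pg = ·ℕ-closed k Pg
    zmul-closed -[1+ k ] Pg = ⁻¹-closed (·ℕ-closed (suc k) Pg)

    gsum-closed : ∀ m (f : Fin m → Carrier) → (∀ i → P (f i)) → P (gsum G m f)
    gsum-closed zero    f Pf = ε-closed
    gsum-closed (suc m) f Pf = ∙-closed (Pf zero) (gsum-closed m (f ∘ suc) (Pf ∘ suc))

    span-closed : ∀ {m} (gen : Fin m → Carrier) →
                  (∀ g → Σ (Fin m → ℤ) λ k → g ≈ gsum G m (λ i → zmul G (k i) (gen i))) →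
                  (∀ i → P (gen i)) → ∀ g → P g
    span-closed {m} gen span Pgen g =
      let k , g≈gsum = span g
      in ∈-resp-≈ (≈-sym g≈gsum) (gsum-closed m _ λ i → zmul-closed (k i) (Pgen i))

module Booleans (M : ℕ) {c ℓ : Level} (G : AbelianGroup c ℓ) (e : AbelianGroup.Carrier G) where
  open AbelianGroup G using (Carrier; _≈_; _∙_; ε; _⁻¹; assoc; identityʳ; identityˡ; inverseˡ; ∙-cong)
    renaming (refl to ≈-refl; trans to ≈-trans)

  private instance
    2^M≢0 : NonZero (2 ^ M)
    2^M≢0 = m^n≢0 2 M

  open ZMod {2 ^ M}

  ∼-oppositeParity : ∀ {u w a b : ZMod2^ M} → (u , w) ∼ (a , b) →
                     OppositeParity M a b → OppositeParity M u w
  ∼-oppositeParity (inj₁ refl) opp = opp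
  ∼-oppositeParity (inj₂ refl) opp = opp ∘ sym

  module _ (α : Carrier → ZMod2^ M) where

    pairAt : Carrier → ZMod2^ M × ZMod2^ M
    pairAt x = α x , α (x ∙ e)

    booleanForSome⇔ : BooleanForSome M G e α ⇔
                      ((∀ x → OppositeParity M (α x) (α (x ∙ e))) × (∀ x → pairAt x ∼ pairAt ε))
    booleanForSome⇔ = mk⇔
      (λ (a , b , _ , opp , values , flips) →
         let pair∼ x = to boolean-pair⇔ (values x , flips x)
         in (λ x → ∼-oppositeParity (pair∼ x) opp) , (λ x → ∼-trans (pair∼ x) (∼-sym (pair∼ ε))))
      (λ (opp , constant) →
         let boolean x = from boolean-pair⇔ (constant x)
         in α ε , α (ε ∙ e) , opp ε ∘ cong (parity M) , opp ε , proj₁ ∘ boolean , proj₂ ∘ boolean)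

    module _ (α-resp : Respects≈ G α) where

      PairInvariant : Carrier → Set c
      PairInvariant z = ∀ x → pairAt (x ∙ z) ∼ pairAt x

      pairAt-cong : ∀ {x y} → x ≈ y → pairAt x ≡ pairAt y
      pairAt-cong x≈y = cong₂ _,_ (α-resp x≈y) (α-resp (∙-cong x≈y ≈-refl))

      pairInvariant-isSubgroup : IsSubgroup G PairInvariant
      pairInvariant-isSubgroup = record
        { ∈-resp-≈  = λ z≈z′ inv x →
            subst (_∼ pairAt x) (pairAt-cong (∙-cong ≈-refl z≈z′)) (inv x)
        ; ε-closed  = λ x → inj₁ (pairAt-cong (identityʳ x))
        ; ∙-closed  = λ {z} {w} inv-z inv-w x →
            subst (_∼ pairAt x) (pairAt-cong (assoc x z w)) (∼-trans (inv-w (x ∙ z)) (inv-z x))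
        ; ⁻¹-closed = λ {z} inv-z x →
            ∼-sym (subst (_∼ pairAt (x ∙ z ⁻¹)) (pairAt-cong (cancel x z)) (inv-z (x ∙ z ⁻¹)))
        }
        where
        cancel : ∀ x z → (x ∙ z ⁻¹) ∙ z ≈ x
        cancel x z = ≈-trans (assoc x (z ⁻¹) z) (≈-trans (∙-cong ≈-refl (inverseˡ z)) (identityʳ x))

      pairAt-constant⇔ : ∀ {n} (gen : Fin n → Carrier) →
                         (∀ g → Σ (Fin n → ℤ) λ k → g ≈ gsum G n (λ i → zmul G (k i) (gen i))) →
                         (∀ x → pairAt x ∼ pairAt ε) ⇔ (∀ i → PairInvariant (gen i))
      pairAt-constant⇔ gen span = mk⇔
        (λ constant i x → ∼-trans (constant (x ∙ gen i)) (∼-sym (constant x)))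
        (λ invariant x → subst (_∼ pairAt ε) (pairAt-cong (identityˡ x))
                           (span-closed G pairInvariant-isSubgroup gen span invariant x ε))

module Construction {c ℓ : Level} (G : AbelianGroup c ℓ) (e : AbelianGroup.Carrier G)
                    (M : ℕ) (M≥1 : M ≥ 1) {n : ℕ} (gen : Fin n → AbelianGroup.Carrier G) where
  open AbelianGroup G using (Carrier; _∙_; ε; assoc; identityʳ) renaming (sym to ≈-sym)
  open Parity M M≥1
  open ZMod {2 ^ M} using (Tiles; tiles-cong)
  open Booleans M G e

  shiftCount : Fin (suc n) → ℕ
  shiftCount zero    = 2
  shiftCount (suc _) = 4

  shifts : (i : Fin (suc n)) → Fin (shiftCount i) → Carrier
  shifts zero    = ε ∷ e ∷ []
  shifts (suc k) = ε ∷ e ∷ gen k ∷ gen k ∙ e ∷ []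

  tileSets : (i : Fin (suc n)) → Fin (shiftCount i) → Subset (2 ^ M)
  tileSets zero    = λ _ → evenSet
  tileSets (suc _) = quadSets

  module _ (α : Carrier → F) (α-resp : Respects≈ G α) where

    parity-tiles⇔ : ∀ x → Tiles (λ j → α (x ∙ shifts zero j)) (tileSets zero) ⇔
                          OppositeParity M (α x) (α (x ∙ e))
    parity-tiles⇔ x = ⇔.trans
      (tiles-cong (tileSets zero) λ { zero       → α-resp (identityʳ x)
                                    ; (suc zero) → refl })
      (tiles-parity⇔ (α x) (α (x ∙ e)))

    generator-tiles⇔ : ∀ x k → OppositeParity M (α x) (α (x ∙ e)) →
                       OppositeParity M (α (x ∙ gen k)) (α ((x ∙ gen k) ∙ e)) →
                       Tiles (λ j → α (x ∙ shifts (suc k) j)) (tileSets (suc k)) ⇔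
                       pairAt α (x ∙ gen k) ∼ pairAt α x
    generator-tiles⇔ x k opp opp′ = ⇔.trans
      (tiles-cong quadSets λ { zero                   → α-resp (identityʳ x)
                             ; (suc zero)             → refl
                             ; (suc (suc zero))       → refl
                             ; (suc (suc (suc zero))) → α-resp (≈-sym (assoc x (gen k) e)) })
      (tiles-quad⇔ opp opp′)

    tiles⇔ : (∀ i x → Tiles (λ j → α (x ∙ shifts i j)) (tileSets i)) ⇔
             ((∀ x → OppositeParity M (α x) (α (x ∙ e))) × (∀ k → PairInvariant α α-resp (gen k)))
    tiles⇔ = mk⇔
      (λ tiles → let opp x = to (parity-tiles⇔ x) (tiles zero x) in
         opp , λ k x → to (generator-tiles⇔ x k (opp x) (opp (x ∙ gen k))) (tiles (suc k) x))
      (λ { (opp , _)         zero    x → from (parity-tiles⇔ x) (opp x)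
         ; (opp , invariant) (suc k) x →
             from (generator-tiles⇔ x k (opp x) (opp (x ∙ gen k))) (invariant k x) })

proposition6p2 : {c ℓ : Level} (G : AbelianGroup c ℓ) → FinitelyGenerated G →
    (e : AbelianGroup.Carrier G) → OrderTwo G e →
    (M : ℕ) → M ≥ 1 →
    Expressible G (2 ^ M) ⦃ m^n≢0 2 M ⦄ (BooleanForSome M G e)
proposition6p2 G (n , gen , span) e _ M M≥1 =
  suc n , shiftCount , shifts , tileSets , λ α α-resp →
    ⇔.trans (booleanForSome⇔ α)
      (⇔.trans (⇔-id _ ×-⇔ pairAt-constant⇔ α α-resp gen span)
               (⇔.sym (tiles⇔ α α-resp)))
  where
  open Construction G e M M≥1 gen
  open Booleans M G e
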